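{- Let $G$ be a finite simple undirected connected AT-free graph of girth at least $5$, let $x,y$ be a dominating pair of $G$ with $\mathrm{dist}(x,y)$ equal to the diameter of $G$, and let $P$ be a shortest $x$-$y$ path with vertices $u_1=x,u_2,\dots,u_d=y$ in order. For $1\le i\le d$ let $S_i=\{v\in V(G)\setminus V(P) : u_i\in N_G(v)\}$. Call a vertex $v\in V(G)\setminus V(P)$ non-pendant if $N_G(v)\cap (V(G)\setminus V(P))\neq\emptyset$. Then for each $1\le i\le d$, $S_i$ contains at most $2$ non-pendant vertices.
   Context: $G$ is AT-free if it has no asteroidal triple (independent set of three vertices such that between each pair there is a path avoiding the neighbourhood of the third). A pair $x,y$ is a dominating pair if the vertex set of every $x$-$y$ path is a dominating set (every other vertex has a neighbour on the path). $N_G(v)$ is the neighbourhood of $v$. -}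

module Defs where

open import Level using (0ℓ)
open import Data.Nat using (ℕ; _≤_; _∸_)
open import Data.Fin using (Fin)
open import Data.List using (List; []; _∷_; length)
open import Data.List.Membership.Propositional using (_∈_; _∉_)
open import Data.List.Relation.Unary.All using (All)
open import Data.List.Relation.Unary.Any using (Any)
open import Data.List.Relation.Unary.Unique.Propositional using (Unique)
open import Data.Product using (Σ; ∃; _×_)
open import Data.Sum using (_⊎_)
open import Relation.Nullary using (¬_)
open import Relation.Binary using (Decidable)
open import Relation.Binary.PropositionalEquality using (_≡_; _≢_)

record Graph (n : ℕ) : Set₁ where
  field
    Adj    : Fin n → Fin n → Set
    adj?   : Decidable Adj
    sym    : ∀ {u v} → Adj u v → Adj v u
    irrefl : ∀ {v} → ¬ Adj v v

module _ {n : ℕ} (G : Graph n) where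
  open Graph G

  data Walk : Fin n → Fin n → List (Fin n) → Set where
    single : ∀ {v} → Walk v v (v ∷ [])
    step   : ∀ {u w v vs} → Adj u w → Walk w v vs → Walk u v (u ∷ vs)

  IsPath : Fin n → Fin n → List (Fin n) → Set
  IsPath u v vs = Walk u v vs × Unique vs

  edges : List (Fin n) → ℕ
  edges vs = length vs ∸ 1

  Connected : Set
  Connected = ∀ u v → ∃ λ vs → Walk u v vs

  Dist : Fin n → Fin n → ℕ → Set
  Dist u v k = (∃ λ vs → IsPath u v vs × edges vs ≡ k)
             × (∀ vs → Walk u v vs → k ≤ edges vs)

  Diametral : Fin n → Fin n → Set
  Diametral x y = ∃ λ D → Dist x y D × (∀ u v k → Dist u v k → k ≤ D)

  ShortestPath : Fin n → Fin n → List (Fin n) → Set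
  ShortestPath x y P = IsPath x y P × (∀ vs → Walk x y vs → edges P ≤ edges vs)

  -- a cycle: closed walk on ≥ 3 distinct vertices a ... b with b ~ a;
  -- its length is the number of vertices
  IsCycle : List (Fin n) → Set
  IsCycle vs = Σ (Fin n) λ a → Σ (Fin n) λ b →
               IsPath a b vs × Adj b a × 3 ≤ length vs

  GirthAtLeast5 : Set
  GirthAtLeast5 = ∀ vs → IsCycle vs → 5 ≤ length vs

  Independent3 : Fin n → Fin n → Fin n → Set
  Independent3 a b c = a ≢ b × b ≢ c × a ≢ c
                     × ¬ Adj a b × ¬ Adj b c × ¬ Adj a c

  Avoids : Fin n → Fin n → Fin n → Set
  Avoids a b c = ∃ λ vs → IsPath a b vs × All (λ w → ¬ Adj w c) vs

  AsteroidalTriple : Fin n → Fin n → Fin n → Set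
  AsteroidalTriple a b c = Independent3 a b c
    × Avoids a b c × Avoids b c a × Avoids a c b

  ATFree : Set
  ATFree = ∀ a b c → ¬ AsteroidalTriple a b c

  Dominating : List (Fin n) → Set
  Dominating vs = ∀ v → v ∉ vs → Any (Adj v) vs

  DominatingPair : Fin n → Fin n → Set
  DominatingPair x y = ∀ vs → IsPath x y vs → Dominating vs

  -- S_i for u = u_i on P
  InS : List (Fin n) → Fin n → Fin n → Set
  InS P u v = v ∉ P × Adj v u

  NonPendant : List (Fin n) → Fin n → Set
  NonPendant P v = v ∉ P × (∃ λ w → w ∉ P × Adj v w)

-- Let u = u_i be the i-th vertex of the shortest x-y path P, and suppose
-- a, b, c are three distinct non-pendant vertices of S_i.  Each of them,
-- say a, has a neighbour a' off P, and since (x, y) is a dominating pair,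
-- a' has a neighbour p on P, at position j say (a "leg" a - a' - p).
--
--  * Girth ≥ 5 forbids triangles and 4-cycles.  Hence p is not within one
--    step of u along P, while the walk u a a' p bounds the distance along
--    the shortest path P by 3: the foot j lies 2 or 3 positions from i.
--  * For two legs with far ends a', b', an edge a'b' would put the feet
--    within 3 positions of each other, hence on the same side of i and at
--    most one step apart; this again closes a triangle or a 4-cycle.
--  * So a', b', c' are pairwise non-adjacent and distinct, and the path
--    a' a u b b' avoids N(c') (every vertex adjacent to c' would close a
--    short cycle).  Thus a', b', c' is an asteroidal triple, contradicting
--    AT-freeness.
module Submission where

open import Defs
open import Data.Nat using (ℕ)
open import Data.Fin using (Fin)
open import Data.List using (List)
open import Data.List.Membership.Propositional using (_∈_)
open import Data.Sum using (_⊎_)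
open import Relation.Binary.PropositionalEquality using (_≡_)

open import Data.Nat using (suc; _+_; _≤_; z≤n; s≤s)
open import Data.Nat.Properties using (+-cancelʳ-≤; +-comm; ≤-pred; m+n≮n)
open import Data.Fin.Properties using (_≟_)
open import Data.List using ([]; _∷_; length)
open import Data.List.Membership.Propositional using (_∉_)
open import Data.List.Relation.Unary.All using (All; []; _∷_)
open import Data.List.Relation.Unary.Any using (Any; here; there)
open import Data.List.Relation.Unary.AllPairs using ([]; _∷_)
open import Data.List.Relation.Unary.Unique.Propositional using (Unique)
open import Data.Product using (∃; _×_; _,_; proj₁; proj₂)
open import Data.Sum using (inj₁; inj₂)
open import Data.Empty using (⊥; ⊥-elim)
open import Function using (_∘_)
open import Relation.Nullary using (¬_; yes; no)
open import Relation.Binary.PropositionalEquality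
  using (refl; sym; trans; cong; subst; subst₂; _≢_; ≢-sym)

-- At vs k v: v is the entry of the list vs at position k (counting from 0).
data At {A : Set} : List A → ℕ → A → Set where
  ahere  : ∀ {v vs} → At (v ∷ vs) 0 v
  athere : ∀ {w vs k v} → At vs k v → At (w ∷ vs) (suc k) v

module _ {A : Set} where

  at-functional : ∀ {vs : List A} {k v w} → At vs k v → At vs k w → v ≡ w
  at-functional ahere      ahere      = refl
  at-functional (athere p) (athere q) = at-functional p q

  at⇒∈ : ∀ {vs : List A} {k v} → At vs k v → v ∈ vs
  at⇒∈ ahere      = here refl
  at⇒∈ (athere p) = there (at⇒∈ p)

  any⇒at : ∀ {Q : A → Set} {vs : List A} → Any Q vs → ∃ λ k → ∃ λ v → At vs k v × Q v
  any⇒at (here q) = 0 , _ , ahere , q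
  any⇒at (there a) with any⇒at a
  ... | k , v , p , q = suc k , v , athere p , q

  ∈⇒at : ∀ {vs : List A} {v} → v ∈ vs → ∃ λ k → At vs k v
  ∈⇒at v∈vs with any⇒at v∈vs
  ... | k , _ , p , refl = k , p

data Close : ℕ → ℕ → Set where
  same : ∀ {i} → Close i i
  next : ∀ {i} → Close i (suc i)
  prev : ∀ {i} → Close (suc i) i

close-suc : ∀ {i j} → Close i j → Close (suc i) (suc j)
close-suc same = same
close-suc next = next
close-suc prev = prev

data Apart : ℕ → ℕ → Set where
  up₂   : ∀ {i} → Apart i (2 + i)
  up₃   : ∀ {i} → Apart i (3 + i)
  down₂ : ∀ {j} → Apart (2 + j) j
  down₃ : ∀ {j} → Apart (3 + j) j

apart-suc : ∀ {i j} → Apart i j → Apart (suc i) (suc j)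
apart-suc up₂   = up₂
apart-suc up₃   = up₃
apart-suc down₂ = down₂
apart-suc down₃ = down₃

apart : ∀ i j → j ≤ 3 + i → i ≤ 3 + j → ¬ Close i j → Apart i j
apart (suc i) (suc j) j≤ i≤ far = apart-suc (apart i j (≤-pred j≤) (≤-pred i≤) (far ∘ close-suc))
apart 0 0                   _ _ far = ⊥-elim (far same)
apart 0 1                   _ _ far = ⊥-elim (far next)
apart 0 2                   _ _ _   = up₂
apart 0 3                   _ _ _   = up₃
apart 0 (suc (suc (suc (suc _)))) (s≤s (s≤s (s≤s ()))) _ _
apart 1 0                   _ _ far = ⊥-elim (far prev)
apart 2 0                   _ _ _   = down₂
apart 3 0                   _ _ _   = down₃
apart (suc (suc (suc (suc _)))) 0 _ (s≤s (s≤s (s≤s ()))) _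

-- Two positions both 2 or 3 away from i and at most 3 from each other lie
-- on the same side of i, hence are close.
same-side : ∀ {i j k} → Apart i j → Apart i k → j ≤ 3 + k → k ≤ 3 + j → Close j k
same-side up₂   up₂   _  _  = same
same-side up₂   up₃   _  _  = next
same-side up₃   up₂   _  _  = prev
same-side up₃   up₃   _  _  = same
same-side down₂ down₂ _  _  = same
same-side down₂ down₃ _  _  = prev
same-side down₃ down₂ _  _  = next
same-side down₃ down₃ _  _  = same
same-side up₂   down₂ j≤ _  = ⊥-elim (m+n≮n 0 _ j≤)
same-side up₂   down₃ j≤ _  = ⊥-elim (m+n≮n 1 _ j≤)
same-side up₃   down₂ j≤ _  = ⊥-elim (m+n≮n 1 _ j≤)
same-side up₃   down₃ j≤ _  = ⊥-elim (m+n≮n 2 _ j≤)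
same-side down₂ up₂   _  k≤ = ⊥-elim (m+n≮n 0 _ k≤)
same-side down₂ up₃   _  k≤ = ⊥-elim (m+n≮n 1 _ k≤)
same-side down₃ up₂   _  k≤ = ⊥-elim (m+n≮n 1 _ k≤)
same-side down₃ up₃   _  k≤ = ⊥-elim (m+n≮n 2 _ k≤)

module _ {n : ℕ} (G : Graph n) where
  open Graph G using (Adj; irrefl) renaming (sym to adj-sym)

  adj⇒≢ : ∀ {a b} → Adj a b → a ≢ b
  adj⇒≢ e refl = irrefl e

  ∉⇒≢ : ∀ {P : List (Fin n)} {v w} → v ∉ P → w ∈ P → v ≢ w
  ∉⇒≢ v∉P w∈P refl = v∉P w∈P

  -- Walkₙ u v k: a walk from u to v with k edges; such walks compose and
  -- reverse, which lets us bound distances along P.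
  data Walkₙ : Fin n → Fin n → ℕ → Set where
    nil  : ∀ {v} → Walkₙ v v 0
    cons : ∀ {u w v k} → Adj u w → Walkₙ w v k → Walkₙ u v (suc k)

  _++ₙ_ : ∀ {u v w k m} → Walkₙ u v k → Walkₙ v w m → Walkₙ u w (k + m)
  nil      ++ₙ q = q
  cons e p ++ₙ q = cons e (p ++ₙ q)

  snocₙ : ∀ {u v w k} → Walkₙ u v k → Adj v w → Walkₙ u w (suc k)
  snocₙ nil        e = cons e nil
  snocₙ (cons d p) e = cons d (snocₙ p e)

  reverseₙ : ∀ {u v k} → Walkₙ u v k → Walkₙ v u k
  reverseₙ nil        = nil
  reverseₙ (cons e p) = snocₙ (reverseₙ p) (adj-sym e)

  walk-length : ∀ {u v vs} → Walk G u v vs → length vs ≡ suc (edges G vs)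
  walk-length single     = refl
  walk-length (step _ _) = refl

  toWalkₙ : ∀ {u v vs} → Walk G u v vs → Walkₙ u v (edges G vs)
  toWalkₙ single = nil
  toWalkₙ {u} {v} (step e w) = subst (Walkₙ u v) (sym (walk-length w)) (cons e (toWalkₙ w))

  fromWalkₙ : ∀ {u v k} → Walkₙ u v k → ∃ λ vs → Walk G u v vs × edges G vs ≡ k
  fromWalkₙ nil = _ , single , refl
  fromWalkₙ (cons e p) with fromWalkₙ p
  ... | vs , w , eq = _ , step e w , trans (walk-length w) (cong suc eq)

  prefix : ∀ {x y vs j p} → Walk G x y vs → At vs j p → Walkₙ x p j
  prefix single     ahere      = nil
  prefix (step _ _) ahere      = nil
  prefix (step e w) (athere a) = cons e (prefix w a)

  suffix : ∀ {x y vs j p} → Walk G x y vs → At vs j p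
         → ∃ λ s → Walkₙ p y s × j + s ≡ edges G vs
  suffix single     ahere      = _ , nil , refl
  suffix (step e w) ahere      = _ , toWalkₙ (step e w) , refl
  suffix (step e w) (athere a) with suffix w a
  ... | s , q , eq = s , q , trans (cong suc eq) (sym (walk-length w))

  consecutive : ∀ {x y vs j v w} → Walk G x y vs → At vs j v → At vs (suc j) w → Adj v w
  consecutive (step e single)     ahere      (athere ahere) = e
  consecutive (step e (step _ _)) ahere      (athere ahere) = e
  consecutive (step _ w)          (athere a) (athere b)     = consecutive w a b

  module Girth5 (girth : GirthAtLeast5 G) where

    no-triangle : ∀ {p q r} → Adj p q → Adj q r → Adj r p → ⊥
    no-triangle {p} {q} {r} pq qr rp = 5≰3 (girth (p ∷ q ∷ r ∷ []) cycle)
      where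
        distinct : Unique (p ∷ q ∷ r ∷ [])
        distinct = (adj⇒≢ pq ∷ ≢-sym (adj⇒≢ rp) ∷ []) ∷ (adj⇒≢ qr ∷ []) ∷ [] ∷ []
        cycle : IsCycle G (p ∷ q ∷ r ∷ [])
        cycle = p , r , (step pq (step qr single) , distinct) , rp , s≤s (s≤s (s≤s z≤n))
        5≰3 : ¬ (5 ≤ 3)
        5≰3 (s≤s (s≤s (s≤s ())))

    no-square : ∀ {p q r s} → Adj p q → Adj q r → Adj r s → Adj s p → p ≢ r → q ≢ s → ⊥
    no-square {p} {q} {r} {s} pq qr rs sp p≢r q≢s = 5≰4 (girth (p ∷ q ∷ r ∷ s ∷ []) cycle)
      where
        distinct : Unique (p ∷ q ∷ r ∷ s ∷ [])
        distinct = (adj⇒≢ pq ∷ p≢r ∷ ≢-sym (adj⇒≢ sp) ∷ [])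
                 ∷ (adj⇒≢ qr ∷ q≢s ∷ []) ∷ (adj⇒≢ rs ∷ []) ∷ [] ∷ []
        cycle : IsCycle G (p ∷ q ∷ r ∷ s ∷ [])
        cycle = p , s , (step pq (step qr (step rs single)) , distinct) , sp , s≤s (s≤s (s≤s z≤n))
        5≰4 : ¬ (5 ≤ 4)
        5≰4 (s≤s (s≤s (s≤s (s≤s ()))))

    unique-common-neighbour : ∀ {a b u w} → a ≢ b
      → Adj a u → Adj b u → Adj a w → Adj b w → w ≡ u
    unique-common-neighbour {u = u} {w} a≢b au bu aw bw with w ≟ u
    ... | yes w≡u = w≡u
    ... | no  w≢u = ⊥-elim (no-square aw (adj-sym bw) bu (adj-sym au) a≢b w≢u)

    no-short-cycle : ∀ {s t p q} → Adj s t → Adj s p → Adj t q → p ≡ q ⊎ Adj p q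
      → s ≢ q → t ≢ p → ⊥
    no-short-cycle st sp tq (inj₁ refl) _   _   = no-triangle st tq (adj-sym sp)
    no-short-cycle st sp tq (inj₂ pq)   s≢q t≢p =
      no-square st tq (adj-sym pq) (adj-sym sp) s≢q t≢p

  module ShortestPathPositions {x y : Fin n} {P : List (Fin n)} (sp : ShortestPath G x y P) where

    walkP : Walk G x y P
    walkP = proj₁ (proj₁ sp)

    -- A walk of length e between the vertices at positions j and k of P
    -- shows that k ≤ e + j: otherwise it would shorten P.
    shortcut : ∀ {j k p q e} → At P j p → At P k q → Walkₙ p q e → k ≤ e + j
    shortcut {j} {k} {e = e} pj qk w with suffix walkP qk
    ... | s , rest , k+s≡ with fromWalkₙ ((prefix walkP pj ++ₙ w) ++ₙ rest)
    ... | vs , walk , edges≡ = subst (k ≤_) (+-comm j e) (+-cancelʳ-≤ s k (j + e) k+s≤)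
      where
        k+s≤ : k + s ≤ (j + e) + s
        k+s≤ = subst₂ _≤_ (sym k+s≡) edges≡ (proj₂ sp vs walk)

    close-on-path : ∀ {j k p q} → At P j p → At P k q → Close j k → p ≡ q ⊎ Adj p q
    close-on-path pj qk same = inj₁ (at-functional pj qk)
    close-on-path pj qk next = inj₂ (consecutive walkP pj qk)
    close-on-path pj qk prev = inj₂ (adj-sym (consecutive walkP qk pj))

  module Legs (girth : GirthAtLeast5 G) {x y : Fin n} {P : List (Fin n)} (sp : ShortestPath G x y P)
              {u : Fin n} {i : ℕ} (ui : At P i u) where
    open Girth5 girth
    open ShortestPathPositions sp

    record Leg (a : Fin n) : Set where
      field
        a∉P      : a ∉ P
        a~u      : Adj a u
        far      : Fin n
        far∉P    : far ∉ P
        a~far    : Adj a far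
        foot     : Fin n
        pos      : ℕ
        foot-at  : At P pos foot
        far~foot : Adj far foot
    open Leg

    leg : DominatingPair G x y → ∀ {a} → InS G P u a → NonPendant G P a → Leg a
    leg dom (a∉P , a~u) (_ , w , w∉P , a~w) with any⇒at (dom P (proj₁ sp) w w∉P)
    ... | j , p , pj , w~p = record
      { a∉P = a∉P ; a~u = a~u ; far = w ; far∉P = w∉P ; a~far = a~w
      ; foot = p ; pos = j ; foot-at = pj ; far~foot = w~p }

    far≢u : ∀ {a} (A : Leg a) → far A ≢ u
    far≢u A = ∉⇒≢ (far∉P A) (at⇒∈ ui)

    far≁u : ∀ {a} (A : Leg a) → ¬ Adj (far A) u
    far≁u A e = no-triangle (a~far A) e (adj-sym (a~u A))

    -- The foot of a leg lies 2 or 3 positions from u: the walk u a far foot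
    -- bounds the distance along P by 3, and a closer foot closes a short cycle.
    foot-apart : ∀ {a} (A : Leg a) → Apart i (pos A)
    foot-apart A = apart i (pos A) (shortcut ui (foot-at A) to-foot)
                                   (shortcut (foot-at A) ui (reverseₙ to-foot)) not-close
      where
        to-foot : Walkₙ u (foot A) 3
        to-foot = cons (adj-sym (a~u A)) (cons (a~far A) (cons (far~foot A) nil))
        not-close : ¬ Close i (pos A)
        not-close c = no-short-cycle (a~far A) (a~u A) (far~foot A)
          (close-on-path ui (foot-at A) c) (∉⇒≢ (a∉P A) (at⇒∈ (foot-at A))) (far≢u A)

    -- Far ends of legs are never adjacent: an edge between them brings the
    -- feet within 3 positions, hence on one side of u and close, which
    -- closes a short cycle.
    far≁far : ∀ {a b} (A : Leg a) (B : Leg b) → ¬ Adj (far A) (far B)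
    far≁far A B e = no-short-cycle e (far~foot A) (far~foot B)
      (close-on-path (foot-at A) (foot-at B) feet-close)
      (∉⇒≢ (far∉P A) (at⇒∈ (foot-at B))) (∉⇒≢ (far∉P B) (at⇒∈ (foot-at A)))
      where
        between : Walkₙ (foot A) (foot B) 3
        between = cons (adj-sym (far~foot A)) (cons e (cons (far~foot B) nil))
        feet-close : Close (pos A) (pos B)
        feet-close = same-side (foot-apart A) (foot-apart B)
          (shortcut (foot-at B) (foot-at A) (reverseₙ between)) (shortcut (foot-at A) (foot-at B) between)

    -- For distinct a, b the only common neighbour of a and b is u, which
    -- separates the two legs.
    far≢far : ∀ {a b} → a ≢ b → (A : Leg a) (B : Leg b) → far A ≢ far B
    far≢far a≢b A B eq = far≢u A
      (unique-common-neighbour a≢b (a~u A) (a~u B) (a~far A) (subst (Adj _) (sym eq) (a~far B)))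

    near≁far : ∀ {a b} → a ≢ b → (A : Leg a) (B : Leg b) → ¬ Adj a (far B)
    near≁far a≢b A B e = far≢u B (unique-common-neighbour a≢b (a~u A) (a~u B) e (a~far B))

    far≢near : ∀ {a b} → a ≢ b → (A : Leg a) (B : Leg b) → far A ≢ b
    far≢near a≢b A B refl = no-triangle (a~far A) (a~u B) (adj-sym (a~u A))

    avoiding-path : ∀ {a b c} → a ≢ b → b ≢ c → a ≢ c → (A : Leg a) (B : Leg b) (C : Leg c)
      → Avoids G (far A) (far B) (far C)
    avoiding-path {a} {b} a≢b b≢c a≢c A B C = _ , (walk , distinct) , avoid
      where
        route : List (Fin n)
        route = far A ∷ a ∷ u ∷ b ∷ far B ∷ []
        walk : Walk G (far A) (far B) route
        walk = step (adj-sym (a~far A)) (step (a~u A) (step (adj-sym (a~u B)) (step (a~far B) single)))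
        distinct : Unique route
        distinct = (≢-sym (adj⇒≢ (a~far A)) ∷ far≢u A ∷ far≢near a≢b A B ∷ far≢far a≢b A B ∷ [])
                 ∷ (adj⇒≢ (a~u A) ∷ a≢b ∷ ≢-sym (far≢near (≢-sym a≢b) B A) ∷ [])
                 ∷ (≢-sym (adj⇒≢ (a~u B)) ∷ ≢-sym (far≢u B) ∷ [])
                 ∷ (adj⇒≢ (a~far B) ∷ [])
                 ∷ [] ∷ []
        avoid : All (λ v → ¬ Adj v (far C)) route
        avoid = far≁far A C ∷ near≁far a≢c A C ∷ far≁u C ∘ adj-sym ∷ near≁far b≢c B C ∷ far≁far B C ∷ []

    asteroidal : ∀ {a b c} → a ≢ b → b ≢ c → a ≢ c → (A : Leg a) (B : Leg b) (C : Leg c)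
      → AsteroidalTriple G (far A) (far B) (far C)
    asteroidal a≢b b≢c a≢c A B C =
        (far≢far a≢b A B , far≢far b≢c B C , far≢far a≢c A C , far≁far A B , far≁far B C , far≁far A C)
      , avoiding-path a≢b b≢c a≢c A B C
      , avoiding-path b≢c (≢-sym a≢c) (≢-sym a≢b) B C A
      , avoiding-path a≢c (≢-sym b≢c) a≢b A C B

lemma5 : ∀ {n : ℕ} (G : Graph n) → Connected G → ATFree G → GirthAtLeast5 G
    → (x y : Fin n) → DominatingPair G x y → Diametral G x y
    → (P : List (Fin n)) → ShortestPath G x y P
    → ∀ u → u ∈ P
    → ∀ a b c
    → InS G P u a → NonPendant G P a
    → InS G P u b → NonPendant G P b
    → InS G P u c → NonPendant G P c
    → a ≡ b ⊎ b ≡ c ⊎ a ≡ c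
lemma5 G _ at-free girth _ _ dom _ P sp u u∈P a b c a∈S a-np b∈S b-np c∈S c-np
  with a ≟ b | b ≟ c | a ≟ c
... | yes a≡b | _       | _       = inj₁ a≡b
... | no _    | yes b≡c | _       = inj₂ (inj₁ b≡c)
... | no _    | no _    | yes a≡c = inj₂ (inj₂ a≡c)
... | no a≢b  | no b≢c  | no a≢c  = ⊥-elim (at-free _ _ _
      (asteroidal a≢b b≢c a≢c (leg dom a∈S a-np) (leg dom b∈S b-np) (leg dom c∈S c-np)))
  where open Legs G girth sp (proj₂ (∈⇒at u∈P))
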